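{- (i) The logic $\mathbf{coQInt}$ is sound and complete with respect to the class of all coquasiintuitionistic algebras. (ii) The logic $\mathbf{QInt}$ is sound and complete with respect to the class of all quasiintuitionistic algebras. (iii) The logic $\mathbf{biQInt}$ is sound and complete with respect to the class of all biquasiintuitionistic algebras.
   Context: Formulas are built from propositional variables and the constants $\bot,\top$ using binary connectives $\wedge,\vee$ and unary connectives $\sim_\bullet$ and/or $\sim_\circ$. A sequent is an ordered pair of formulas, written $p\vdash q$. Consider the axiom schemata (for all formulas $p,q,r$): a1) $p\vdash p$; a2) $p\wedge q\vdash p$; a3) $p\wedge q\vdash q$; a4) $p\vdash p\vee q$; a5) $q\vdash p\vee q$; a6) $p\wedge(q\vee r)\vdash (p\wedge q)\vee(p\wedge r)$; a7) $\sim_\bullet\sim_\bullet p\vdash p$; a8) $q\vdash p\vee \sim_\bullet p$; a9) $p\vdash \sim_\circ\sim_\circ p$; a10) $p\wedge\sim_\circ p\vdash q$; a11) $\sim_\bullet\top\vdash\bot$; a12) $\top\vdash\sim_\circ\bot$; a13) $p\vdash\top$; a14) $\bot\vdash p$; and rules: r1) if $p\vdash q$ and $q\vdash r$ then $p\vdash r$; r2) if $p\vdash q$ and $p\vdash r$ then $p\vdash q\wedge r$; r3) if $p\vdash r$ and $q\vdash r$ then $p\vee q\vdash r$; r4) if $p\vdash q$ then $\sim_\bullet q\vdash\sim_\bullet p$; r5) if $p\vdash q$ then $\sim_\circ q\vdash\sim_\circ p$. $\mathbf{coQInt}$ is the set of sequents in the language with $\wedge,\vee,\bot,\top,\sim_\bullet$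 consisting of instances of a1–a8, a11, a13, a14 and all sequents obtained from them by rules r1–r4 and substitution. $\mathbf{QInt}$ is the set of sequents in the language with $\wedge,\vee,\bot,\top,\sim_\circ$ generated by a1–a6, a9, a10, a12–a14 with rules r1–r3, r5 and substitution. $\mathbf{biQInt}$ is the set of sequents in the language with both $\sim_\bullet,\sim_\circ$ generated by a1–a14 with rules r1–r5 and substitution. A coquasiintuitionistic algebra is a bounded distributive lattice $(K,\le,\wedge,\vee,0,1)$ with a map ${}^\bullet:K\to K$ such that for all $x,y$: $x\le y$ implies $y^\bullet\le x^\bullet$; $x^{\bullet\bullet}\le x$; $y\le x\vee x^\bullet$. A quasiintuitionistic algebra is a bounded distributive lattice with ${}^\circ:K\to K$ such that for all $x,y$: $x\le y$ implies $y^\circ\le x^\circ$; $x\le x^{\circ\circ}$; $x\wedge x^\circ\le y$. A biquasiintuitionistic algebra is a bounded distributive lattice with maps ${}^\bullet,{}^\circ$ making it both a coquasiintuitionistic (w.r.t. ${}^\bullet$) and quasiintuitionistic (w.r.t. ${}^\circ$) algebra. A valuation $\chi$ into such a structure maps formulas to $K$ with $\chi(p\wedge q)=\chi(p)\wedge\chi(q)$, $\chi(p\vee q)=\chi(p)\vee\chi(q)$, $\chi(\bot)=0$, $\chi(\top)=1$, $\chi(\sim_\bullet p)=\chi(p)^\bullet$, $\chi(\sim_\circ p)=\chi(p)^\circ$. A sequent $p\vdash q$ is valid in a structure if $\chi(p)\le\chi(q)$ for every valuation. A logic is sound w.r.t. a class if each of its sequents is valid in every member, and complete if every sequent (of its language)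 valid in all members belongs to the logic. -}

module Defs where

open import Level using (Level; _⊔_; Setω) renaming (suc to lsuc; zero to lzero)
open import Data.Nat using (ℕ)
open import Data.Bool using (Bool; true; false; T)
open import Data.Unit using (tt)
open import Data.Product using (_×_)
open import Relation.Binary using (Rel)
open import Algebra.Core using (Op₁; Op₂)
open import Relation.Binary.Lattice.Structures using (IsBoundedLattice)
open import Algebra.Definitions using (_DistributesOverˡ_)

-- Fm b c : formulas over propositional variables (indexed by ℕ)
-- with ⊥, ⊤, ∧, ∨, and the unary connective ∼• available iff b = true,
-- ∼∘ available iff c = true.
--   coQInt language : Fm true  false
--   QInt   language : Fm false true
--   biQInt language : Fm true  true

data Fm (b c : Bool) : Set where
  var  : ℕ → Fm b c
  ⊥f   : Fm b c
  ⊤f   : Fm b c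
  _∧f_ : Fm b c → Fm b c → Fm b c
  _∨f_ : Fm b c → Fm b c → Fm b c
  ∼•_  : {{T b}} → Fm b c → Fm b c
  ∼∘_  : {{T c}} → Fm b c → Fm b c

infixr 6 _∧f_
infixr 5 _∨f_
infix  7 ∼•_ ∼∘_

subst : ∀ {b c} → (ℕ → Fm b c) → Fm b c → Fm b c
subst σ (var n)   = σ n
subst σ ⊥f        = ⊥f
subst σ ⊤f        = ⊤f
subst σ (p ∧f q)  = subst σ p ∧f subst σ q
subst σ (p ∨f q)  = subst σ p ∨f subst σ q
subst σ (∼• p)    = ∼• subst σ p
subst σ (∼∘ p)    = ∼∘ subst σ p

data Derivable {b c : Bool} : Fm b c → Fm b c → Set where
  a1  : ∀ p → Derivable p p
  a2  : ∀ p q → Derivable (p ∧f q) p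
  a3  : ∀ p q → Derivable (p ∧f q) q
  a4  : ∀ p q → Derivable p (p ∨f q)
  a5  : ∀ p q → Derivable q (p ∨f q)
  a6  : ∀ p q r → Derivable (p ∧f (q ∨f r)) ((p ∧f q) ∨f (p ∧f r))
  a7  : {{_ : T b}} → ∀ p → Derivable (∼• ∼• p) p
  a8  : {{_ : T b}} → ∀ p q → Derivable q (p ∨f ∼• p)
  a9  : {{_ : T c}} → ∀ p → Derivable p (∼∘ ∼∘ p)
  a10 : {{_ : T c}} → ∀ p q → Derivable (p ∧f ∼∘ p) q
  a11 : {{_ : T b}} → Derivable (∼• ⊤f) ⊥f
  a12 : {{_ : T c}} → Derivable ⊤f (∼∘ ⊥f)
  a13 : ∀ p → Derivable p ⊤f
  a14 : ∀ p → Derivable ⊥f p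
  r1  : ∀ {p q r} → Derivable p q → Derivable q r → Derivable p r
  r2  : ∀ {p q r} → Derivable p q → Derivable p r → Derivable p (q ∧f r)
  r3  : ∀ {p q r} → Derivable p r → Derivable q r → Derivable (p ∨f q) r
  r4  : {{_ : T b}} → ∀ {p q} → Derivable p q → Derivable (∼• q) (∼• p)
  r5  : {{_ : T c}} → ∀ {p q} → Derivable p q → Derivable (∼∘ q) (∼∘ p)
  sub : ∀ (σ : ℕ → Fm b c) {p q} → Derivable p q
        → Derivable (subst σ p) (subst σ q)

coQInt : Fm true false → Fm true false → Set
coQInt = Derivable

QInt : Fm false true → Fm false true → Set
QInt = Derivable

biQInt : Fm true true → Fm true true → Set
biQInt = Derivable

record BDL (a ℓ₁ ℓ₂ : Level) : Set (lsuc (a ⊔ ℓ₁ ⊔ ℓ₂)) where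
  infixr 6 _∧_
  infixr 5 _∨_
  infix  4 _≈_ _≤_
  field
    Carrier          : Set a
    _≈_              : Rel Carrier ℓ₁
    _≤_              : Rel Carrier ℓ₂
    _∨_              : Op₂ Carrier
    _∧_              : Op₂ Carrier
    top              : Carrier
    bot              : Carrier
    isBoundedLattice : IsBoundedLattice _≈_ _≤_ _∨_ _∧_ top bot
    ∧-distribˡ-∨     : _DistributesOverˡ_ _≈_ _∧_ _∨_

IsCoQuasi : ∀ {a ℓ₁ ℓ₂} (L : BDL a ℓ₁ ℓ₂) → Op₁ (BDL.Carrier L) → Set (a ⊔ ℓ₂)
IsCoQuasi L • =
  (∀ x y → x ≤ y → • y ≤ • x) ×
  (∀ x → • (• x) ≤ x) ×
  (∀ x y → y ≤ x ∨ • x)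
  where open BDL L

IsQuasi : ∀ {a ℓ₁ ℓ₂} (L : BDL a ℓ₁ ℓ₂) → Op₁ (BDL.Carrier L) → Set (a ⊔ ℓ₂)
IsQuasi L ∘ =
  (∀ x y → x ≤ y → ∘ y ≤ ∘ x) ×
  (∀ x → x ≤ ∘ (∘ x)) ×
  (∀ x y → x ∧ ∘ x ≤ y)
  where open BDL L

record Alg (b c : Bool) (a ℓ₁ ℓ₂ : Level) : Set (lsuc (a ⊔ ℓ₁ ⊔ ℓ₂)) where
  field
    lattice : BDL a ℓ₁ ℓ₂
  open BDL lattice public
  field
    •op : {{T b}} → Op₁ Carrier
    ∘op : {{T c}} → Op₁ Carrier
    •ax : {{_ : T b}} → IsCoQuasi lattice •op
    ∘ax : {{_ : T c}} → IsQuasi lattice ∘op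

CoQuasiAlgebra : (a ℓ₁ ℓ₂ : Level) → Set (lsuc (a ⊔ ℓ₁ ⊔ ℓ₂))
CoQuasiAlgebra = Alg true false

QuasiAlgebra : (a ℓ₁ ℓ₂ : Level) → Set (lsuc (a ⊔ ℓ₁ ⊔ ℓ₂))
QuasiAlgebra = Alg false true

BiQuasiAlgebra : (a ℓ₁ ℓ₂ : Level) → Set (lsuc (a ⊔ ℓ₁ ⊔ ℓ₂))
BiQuasiAlgebra = Alg true true

⟦_⟧ : ∀ {b c a ℓ₁ ℓ₂} {K : Alg b c a ℓ₁ ℓ₂} → Fm b c
      → (ℕ → Alg.Carrier K) → Alg.Carrier K
⟦_⟧ {K = K} (var n)  v = v n
⟦_⟧ {K = K} ⊥f       v = Alg.bot K
⟦_⟧ {K = K} ⊤f       v = Alg.top K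
⟦_⟧ {K = K} (p ∧f q) v = Alg._∧_ K (⟦_⟧ {K = K} p v) (⟦_⟧ {K = K} q v)
⟦_⟧ {K = K} (p ∨f q) v = Alg._∨_ K (⟦_⟧ {K = K} p v) (⟦_⟧ {K = K} q v)
⟦_⟧ {K = K} (∼• p)   v = Alg.•op K (⟦_⟧ {K = K} p v)
⟦_⟧ {K = K} (∼∘ p)   v = Alg.∘op K (⟦_⟧ {K = K} p v)

ValidIn : ∀ {b c a ℓ₁ ℓ₂} (K : Alg b c a ℓ₁ ℓ₂) → Fm b c → Fm b c → Set (a ⊔ ℓ₂)
ValidIn K p q = ∀ (v : ℕ → Alg.Carrier K) → Alg._≤_ K (⟦_⟧ {K = K} p v) (⟦_⟧ {K = K} q v)

Sound : (b c : Bool) → Setω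
Sound b c = ∀ {a ℓ₁ ℓ₂} {p q : Fm b c} → Derivable p q
            → (K : Alg b c a ℓ₁ ℓ₂) → ValidIn K p q

Complete : (b c : Bool) → Set₁
Complete b c = ∀ (p q : Fm b c)
               → ((K : Alg b c lzero lzero lzero) → ValidIn K p q)
               → Derivable p q

-- "Sound and complete" (Setω because soundness quantifies over all levels).
record SoundComplete (b c : Bool) : Setω where
  field
    soundness    : Sound b c
    completeness : Complete b c

record _∧ω_ (A B : Setω) : Setω where
  constructor _,ω_
  field
    fst : A
    snd : B
infixr 2 _∧ω_

-- Soundness: every axiom is a valid inequality of the algebras and every rule
-- preserves validity; closure under substitution holds because evaluating
-- subst σ p at v is evaluating p at the valuation n ↦ ⟦ σ n ⟧ v.
-- Completeness: formulas preordered by derivability form the Lindenbaum–Tarski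
-- algebra, which is itself an algebra of the class, and under the valuation
-- var every formula denotes itself; so a sequent valid there is derivable.
module Submission where

open import Defs
open import Data.Bool using (Bool; true; false; T)
open import Data.Product using (_×_; _,_; proj₁; proj₂; swap)
open import Data.Nat using (ℕ)
open import Relation.Binary.PropositionalEquality using (_≡_; refl; sym; cong; cong₂; subst₂)
open import Relation.Binary.Lattice.Structures using (IsBoundedLattice)
open import Relation.Binary.Structures using (IsPartialOrder)

module Semantics {b c : Bool} {a ℓ₁ ℓ₂} (K : Alg b c a ℓ₁ ℓ₂) where
  open Alg K
  open IsBoundedLattice isBoundedLattice renaming (refl to ≤-refl; trans to ≤-trans)

  eval : Fm b c → (ℕ → Carrier) → Carrier
  eval = ⟦_⟧ {K = K}

  •-antitone : {{_ : T b}} → ∀ {x y} → x ≤ y → •op y ≤ •op x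
  •-antitone = proj₁ •ax _ _

  ••-deflationary : {{_ : T b}} → ∀ x → •op (•op x) ≤ x
  ••-deflationary = proj₁ (proj₂ •ax)

  ∨•-top : {{_ : T b}} → ∀ x y → y ≤ x ∨ •op x
  ∨•-top = proj₂ (proj₂ •ax)

  ∘-antitone : {{_ : T c}} → ∀ {x y} → x ≤ y → ∘op y ≤ ∘op x
  ∘-antitone = proj₁ ∘ax _ _

  ∘∘-inflationary : {{_ : T c}} → ∀ x → x ≤ ∘op (∘op x)
  ∘∘-inflationary = proj₁ (proj₂ ∘ax)

  ∧∘-bot : {{_ : T c}} → ∀ x y → x ∧ ∘op x ≤ y
  ∧∘-bot = proj₂ (proj₂ ∘ax)

  -- •⊤ ≤ ••⊥ ≤ ⊥, since •⊥ ≤ ⊤.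
  •top≤bot : {{_ : T b}} → •op top ≤ bot
  •top≤bot = ≤-trans (•-antitone (maximum (•op bot))) (••-deflationary bot)

  top≤∘bot : {{_ : T c}} → top ≤ ∘op bot
  top≤∘bot = ≤-trans (∘∘-inflationary top) (∘-antitone (minimum (∘op top)))

  eval-subst : ∀ (σ : ℕ → Fm b c) p v → eval (subst σ p) v ≡ eval p (λ n → eval (σ n) v)
  eval-subst σ (var n)  v = refl
  eval-subst σ ⊥f       v = refl
  eval-subst σ ⊤f       v = refl
  eval-subst σ (p ∧f q) v = cong₂ _∧_ (eval-subst σ p v) (eval-subst σ q v)
  eval-subst σ (p ∨f q) v = cong₂ _∨_ (eval-subst σ p v) (eval-subst σ q v)
  eval-subst σ (∼• p)   v = cong •op (eval-subst σ p v)
  eval-subst σ (∼∘ p)   v = cong ∘op (eval-subst σ p v)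

  derivable⇒valid : ∀ {p q : Fm b c} → Derivable p q → ValidIn K p q
  derivable⇒valid (a1 p)       v = ≤-refl
  derivable⇒valid (a2 p q)     v = x∧y≤x _ _
  derivable⇒valid (a3 p q)     v = x∧y≤y _ _
  derivable⇒valid (a4 p q)     v = x≤x∨y _ _
  derivable⇒valid (a5 p q)     v = y≤x∨y _ _
  derivable⇒valid (a6 p q r)   v = reflexive (∧-distribˡ-∨ _ _ _)
  derivable⇒valid (a7 p)       v = ••-deflationary _
  derivable⇒valid (a8 p q)     v = ∨•-top _ _
  derivable⇒valid (a9 p)       v = ∘∘-inflationary _
  derivable⇒valid (a10 p q)    v = ∧∘-bot _ _
  derivable⇒valid a11          v = •top≤bot
  derivable⇒valid a12          v = top≤∘bot
  derivable⇒valid (a13 p)      v = maximum _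
  derivable⇒valid (a14 p)      v = minimum _
  derivable⇒valid (r1 d e)     v = ≤-trans (derivable⇒valid d v) (derivable⇒valid e v)
  derivable⇒valid (r2 d e)     v = ∧-greatest (derivable⇒valid d v) (derivable⇒valid e v)
  derivable⇒valid (r3 d e)     v = ∨-least (derivable⇒valid d v) (derivable⇒valid e v)
  derivable⇒valid (r4 d)       v = •-antitone (derivable⇒valid d v)
  derivable⇒valid (r5 d)       v = ∘-antitone (derivable⇒valid d v)
  derivable⇒valid (sub σ {p} {q} d) v =
    subst₂ _≤_ (sym (eval-subst σ p v)) (sym (eval-subst σ q v))
      (derivable⇒valid d (λ n → eval (σ n) v))

sound : ∀ b c → Sound b c
sound b c d K = Semantics.derivable⇒valid K d

module Lindenbaum (b c : Bool) where
  _≈_ : Fm b c → Fm b c → Set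
  p ≈ q = Derivable p q × Derivable q p

  derivable-isPartialOrder : IsPartialOrder _≈_ Derivable
  derivable-isPartialOrder = record
    { isPreorder = record
      { isEquivalence = record
        { refl  = a1 _ , a1 _
        ; sym   = swap
        ; trans = λ (p⊢q , q⊢p) (q⊢r , r⊢q) → r1 p⊢q q⊢r , r1 r⊢q q⊢p
        }
      ; reflexive = proj₁
      ; trans     = r1
      }
    ; antisym = _,_
    }

  ∧f-distribˡ-∨f : ∀ p q r → (p ∧f (q ∨f r)) ≈ ((p ∧f q) ∨f (p ∧f r))
  ∧f-distribˡ-∨f p q r =
    a6 p q r , r3 (r2 (a2 _ _) (r1 (a3 _ _) (a4 _ _))) (r2 (a2 _ _) (r1 (a3 _ _) (a5 _ _)))

  lattice : BDL _ _ _
  lattice = record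
    { Carrier = Fm b c ; _≈_ = _≈_ ; _≤_ = Derivable ; _∨_ = _∨f_ ; _∧_ = _∧f_
    ; top = ⊤f ; bot = ⊥f
    ; isBoundedLattice = record
      { isLattice = record
        { isPartialOrder = derivable-isPartialOrder
        ; supremum = λ p q → a4 p q , a5 p q , λ _ → r3
        ; infimum  = λ p q → a2 p q , a3 p q , λ _ → r2
        }
      ; maximum = a13
      ; minimum = a14
      }
    ; ∧-distribˡ-∨ = ∧f-distribˡ-∨f
    }

  algebra : Alg b c _ _ _
  algebra = record
    { lattice = lattice
    ; •op = ∼•_
    ; ∘op = ∼∘_
    ; •ax = (λ _ _ → r4) , a7 , a8
    ; ∘ax = (λ _ _ → r5) , a9 , a10
    }

  eval-var : ∀ p → ⟦_⟧ {K = algebra} p var ≡ p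
  eval-var (var n)  = refl
  eval-var ⊥f       = refl
  eval-var ⊤f       = refl
  eval-var (p ∧f q) = cong₂ _∧f_ (eval-var p) (eval-var q)
  eval-var (p ∨f q) = cong₂ _∨f_ (eval-var p) (eval-var q)
  eval-var (∼• p)   = cong ∼•_ (eval-var p)
  eval-var (∼∘ p)   = cong ∼∘_ (eval-var p)

  complete : Complete b c
  complete p q valid = subst₂ Derivable (eval-var p) (eval-var q) (valid algebra var)

soundComplete : ∀ b c → SoundComplete b c
soundComplete b c = record { soundness = sound b c ; completeness = Lindenbaum.complete b c }

mainTheorem1 : SoundComplete true false
    ∧ω SoundComplete false true
    ∧ω SoundComplete true true
mainTheorem1 = soundComplete true false ,ω (soundComplete false true ,ω soundComplete true true)
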